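{- Let $\mathcal{A}=\langle A,\twoheadrightarrow,\rightarrow,\top\rangle$ be a Semi-BCI algebra. If, for some binary relation $\leq$ on $A$, $\langle A,\leq,\twoheadrightarrow,\rightarrow,\top\rangle$ is also a pseudo-BCI algebra, then $\langle A,\rightarrow,\top\rangle$ is a BCI-algebra.
   Context: A BCI-algebra is a structure $\langle A,\rightarrow,\top\rangle$ such that for all $x,y,z\in A$: (C1) $(y\rightarrow z)\rightarrow((z\rightarrow x)\rightarrow(y\rightarrow x))=\top$; (C2) $x\rightarrow((x\rightarrow y)\rightarrow y)=\top$; (C3) $x\rightarrow x=\top$; (C4) $x\rightarrow y=\top$ and $y\rightarrow x=\top$ imply $x=y$. A Semi-BCI (SBCI) algebra is a structure $\langle A,\twoheadrightarrow,\rightarrow,\top\rangle$, where $x\ll y$ iff $x\twoheadrightarrow y=\top$ and $x\preceq y$ iff $x\rightarrow y=\top$, such that for all $x,y,z$: (S1) $x\twoheadrightarrow(y\twoheadrightarrow z)=y\twoheadrightarrow(x\twoheadrightarrow z)$; (S2) $x\rightarrow(y\rightarrow z)=y\rightarrow(x\rightarrow z)$; (S3) $x\twoheadrightarrow y\preceq(z\twoheadrightarrow x)\rightarrow(z\twoheadrightarrow y)$; (S4) $\top\twoheadrightarrow x=x$; (S5) if $x\ll y\preceq z$ then $x\ll z$; (S6) if $x\preceq y\ll z$ then $x\ll z$; (S7) if $x\preceq y$ and $y\preceq x$ then $x=y$. A pseudo-BCI algebra is a structure $\langle A,\leq,\twoheadrightarrow,\rightarrow,\top\rangle$ with $\leq$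 a binary relation such that for all $x,y,z$: (P1) $x\twoheadrightarrow y\leq(y\twoheadrightarrow z)\rightarrow(x\twoheadrightarrow z)$; (P2) $x\rightarrow y\leq(y\rightarrow z)\twoheadrightarrow(x\rightarrow z)$; (P3) $x\leq(x\twoheadrightarrow y)\rightarrow y$; (P4) $x\leq(x\rightarrow y)\twoheadrightarrow y$; (P5) $x\leq x$; (P6) $x\leq y$ and $y\leq x$ imply $x=y$; (P7) $x\leq y$ iff $x\twoheadrightarrow y=\top$ iff $x\rightarrow y=\top$. -}

module Defs where

open import Level using (Level; _⊔_; suc)
open import Relation.Binary.PropositionalEquality using (_≡_)
open import Data.Product using (_×_)
open import Function.Bundles using (_⇔_)

record IsBCI {a} (A : Set a) (_⇒_ : A → A → A) (⊤ : A) : Set a where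
  field
    C1 : ∀ x y z → ((y ⇒ z) ⇒ ((z ⇒ x) ⇒ (y ⇒ x))) ≡ ⊤
    C2 : ∀ x y → (x ⇒ ((x ⇒ y) ⇒ y)) ≡ ⊤
    C3 : ∀ x → (x ⇒ x) ≡ ⊤
    C4 : ∀ x y → (x ⇒ y) ≡ ⊤ → (y ⇒ x) ≡ ⊤ → x ≡ y

record IsSBCI {a} (A : Set a) (_↠_ : A → A → A) (_⇒_ : A → A → A) (⊤ : A) : Set a where
  _≪_ : A → A → Set a
  x ≪ y = (x ↠ y) ≡ ⊤
  _≼_ : A → A → Set a
  x ≼ y = (x ⇒ y) ≡ ⊤
  field
    S1 : ∀ x y z → (x ↠ (y ↠ z)) ≡ (y ↠ (x ↠ z))
    S2 : ∀ x y z → (x ⇒ (y ⇒ z)) ≡ (y ⇒ (x ⇒ z))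
    S3 : ∀ x y z → (x ↠ y) ≼ ((z ↠ x) ⇒ (z ↠ y))
    S4 : ∀ x → (⊤ ↠ x) ≡ x
    S5 : ∀ x y z → x ≪ y → y ≼ z → x ≪ z
    S6 : ∀ x y z → x ≼ y → y ≪ z → x ≪ z
    S7 : ∀ x y → x ≼ y → y ≼ x → x ≡ y

record IsPseudoBCI {a ℓ} (A : Set a) (_≤_ : A → A → Set ℓ)
                   (_↠_ : A → A → A) (_⇒_ : A → A → A) (⊤ : A) : Set (a ⊔ ℓ) where
  field
    P1 : ∀ x y z → (x ↠ y) ≤ ((y ↠ z) ⇒ (x ↠ z))
    P2 : ∀ x y z → (x ⇒ y) ≤ ((y ⇒ z) ↠ (x ⇒ z))
    P3 : ∀ x y → x ≤ ((x ↠ y) ⇒ y)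
    P4 : ∀ x y → x ≤ ((x ⇒ y) ↠ y)
    P5 : ∀ x → x ≤ x
    P6 : ∀ x y → x ≤ y → y ≤ x → x ≡ y
    P7a : ∀ x y → x ≤ y ⇔ ((x ↠ y) ≡ ⊤)
    P7b : ∀ x y → x ≤ y ⇔ ((x ⇒ y) ≡ ⊤)

module Submission where

-- By P7 the order ≤
-- coincides with both ≪ and ≼, so the S-axioms become order facts:
-- S5 makes ≤ transitive and S4 makes ⊤ the top element (⊤ ≤ t forces t = ⊤).
-- From P2 and the top property, → is antitone in its first argument; with
-- P3 this yields the exchange rule  x ≤ y ↠ z  ⟹  y ≤ x → z.
-- The BCI axioms then follow: C3 and C4 are P5 and P6 read through P7,
-- C2 is C3 after exchanging premises with S2, and C1 is P2 with its two
-- premises exchanged (first by the exchange rule, then by S2).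

open import Defs
open import Relation.Binary.PropositionalEquality
  using (_≡_; sym; trans; subst; module ≡-Reasoning)
open import Function.Bundles using (Equivalence)

module SBCIWithPseudoBCI
  {a ℓ} {A : Set a} {_↠_ _⇒_ : A → A → A} {⊤ : A}
  (S : IsSBCI A _↠_ _⇒_ ⊤)
  {_≤_ : A → A → Set ℓ} (P : IsPseudoBCI A _≤_ _↠_ _⇒_ ⊤)
  where

  open IsSBCI S using (S2; S4; S5)
  open IsPseudoBCI P using (P2; P3; P5; P6; P7a; P7b)

  ≤⇒↠⊤ : ∀ {x y} → x ≤ y → (x ↠ y) ≡ ⊤
  ≤⇒↠⊤ = Equivalence.to (P7a _ _)

  ↠⊤⇒≤ : ∀ {x y} → (x ↠ y) ≡ ⊤ → x ≤ y
  ↠⊤⇒≤ = Equivalence.from (P7a _ _)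

  ≤⇒⇒⊤ : ∀ {x y} → x ≤ y → (x ⇒ y) ≡ ⊤
  ≤⇒⇒⊤ = Equivalence.to (P7b _ _)

  ⇒⊤⇒≤ : ∀ {x y} → (x ⇒ y) ≡ ⊤ → x ≤ y
  ⇒⊤⇒≤ = Equivalence.from (P7b _ _)

  ≤-trans : ∀ {x y z} → x ≤ y → y ≤ z → x ≤ z
  ≤-trans {x} {y} {z} x≤y y≤z = ↠⊤⇒≤ (S5 x y z (≤⇒↠⊤ x≤y) (≤⇒⇒⊤ y≤z))

  ⊤-maximal : ∀ {t} → ⊤ ≤ t → t ≡ ⊤
  ⊤-maximal {t} ⊤≤t = trans (sym (S4 t)) (≤⇒↠⊤ ⊤≤t)

  -- → is antitone in its first argument.  By P2, x → u ≤ (u → z) ↠ (x → z),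
  -- and x → u = ⊤, so the right-hand side is ⊤ by maximality.
  ⇒-antitone : ∀ {x u} z → x ≤ u → (u ⇒ z) ≤ (x ⇒ z)
  ⇒-antitone {x} {u} z x≤u = ↠⊤⇒≤ (⊤-maximal ⊤≤[u⇒z]↠[x⇒z])
    where
    ⊤≤[u⇒z]↠[x⇒z] : ⊤ ≤ ((u ⇒ z) ↠ (x ⇒ z))
    ⊤≤[u⇒z]↠[x⇒z] = subst (λ t → t ≤ ((u ⇒ z) ↠ (x ⇒ z))) (≤⇒⇒⊤ x≤u) (P2 x u z)

  -- Exchange rule: x ≤ y ↠ z implies y ≤ x → z, since
  -- y ≤ (y ↠ z) → z  (P3)  ≤ x → z  (antitonicity).
  exchange : ∀ {x y z} → x ≤ (y ↠ z) → y ≤ (x ⇒ z)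
  exchange {x} {y} {z} x≤y↠z = ≤-trans (P3 y z) (⇒-antitone z x≤y↠z)

  C3 : ∀ x → (x ⇒ x) ≡ ⊤
  C3 x = ≤⇒⇒⊤ (P5 x)

  C4 : ∀ x y → (x ⇒ y) ≡ ⊤ → (y ⇒ x) ≡ ⊤ → x ≡ y
  C4 x y x≼y y≼x = P6 x y (⇒⊤⇒≤ x≼y) (⇒⊤⇒≤ y≼x)

  C2 : ∀ x y → (x ⇒ ((x ⇒ y) ⇒ y)) ≡ ⊤
  C2 x y = begin
    x ⇒ ((x ⇒ y) ⇒ y)   ≡⟨ S2 x (x ⇒ y) y ⟩
    (x ⇒ y) ⇒ (x ⇒ y)   ≡⟨ C3 (x ⇒ y) ⟩
    ⊤                   ∎
    where open ≡-Reasoning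

  -- P2 gives y → z ≤ (z → x) ↠ (y → x); exchanging yields
  -- z → x ≤ (y → z) → (y → x), and S2 swaps the premises back.
  C1 : ∀ x y z → ((y ⇒ z) ⇒ ((z ⇒ x) ⇒ (y ⇒ x))) ≡ ⊤
  C1 x y z = begin
    (y ⇒ z) ⇒ ((z ⇒ x) ⇒ (y ⇒ x))   ≡⟨ S2 (y ⇒ z) (z ⇒ x) (y ⇒ x) ⟩
    (z ⇒ x) ⇒ ((y ⇒ z) ⇒ (y ⇒ x))   ≡⟨ ≤⇒⇒⊤ (exchange (P2 y z x)) ⟩
    ⊤                               ∎
    where open ≡-Reasoning

proposition17 : ∀ {a ℓ} (A : Set a) (_↠_ : A → A → A) (_⇒_ : A → A → A) (⊤ : A)
    → IsSBCI A _↠_ _⇒_ ⊤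
    → (_≤_ : A → A → Set ℓ) → IsPseudoBCI A _≤_ _↠_ _⇒_ ⊤
    → IsBCI A _⇒_ ⊤
proposition17 A _↠_ _⇒_ ⊤ S _≤_ P =
  record { C1 = C1 ; C2 = C2 ; C3 = C3 ; C4 = C4 }
  where open SBCIWithPseudoBCI S P
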